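{- Let $n\ge 1$ and $m\ge 0$ be integers. The number of permutations $\sigma\in\mathcal{S}_{nm}$ that avoid $132$ and are a concatenation of $m$ increasing sequences of length $n$ (i.e. $\sigma_{(i-1)n+1}<\sigma_{(i-1)n+2}<\dots<\sigma_{in}$ for each $1\le i\le m$) is $$\frac{1}{nm+1}\binom{(n+1)m}{m}.$$
   Context: $\mathcal{S}_N$ is the set of permutations of $\{1,\dots,N\}$; $\sigma$ avoids $132$ if there are no indices $a<b<c$ with $\sigma_a<\sigma_c<\sigma_b$. -}

module Defs where

open import Data.Nat using (ℕ; zero; suc; _+_; _*_; _<_)
open import Data.Fin using (Fin; toℕ)
open import Data.Vec using (Vec; lookup)
open import Data.Product using (_×_; Σ)
open import Relation.Binary.PropositionalEquality using (_≡_)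
open import Relation.Nullary using (¬_)
open import Function.Definitions using (Injective)

-- A permutation of {1..N} in one-line notation (0-indexed: values in Fin N),
-- σ_a = lookup σ a.  It is a permutation iff it is injective (equivalently
-- bijective, as Fin N is finite).
IsPerm : {N : ℕ} → Vec (Fin N) N → Set
IsPerm σ = Injective _≡_ _≡_ (lookup σ)

Avoids132 : {N : ℕ} → Vec (Fin N) N → Set
Avoids132 {N} σ = (a b c : Fin N) → toℕ a < toℕ b → toℕ b < toℕ c →
  ¬ ((toℕ (lookup σ a) < toℕ (lookup σ c)) × (toℕ (lookup σ c) < toℕ (lookup σ b)))

BlockIncreasing : (n m : ℕ) → Vec (Fin (n * m)) (n * m) → Set
BlockIncreasing n m σ = (a b : Fin (n * m)) (i j : ℕ) → i < m → suc j < n →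
  toℕ a ≡ i * n + j → toℕ b ≡ i * n + suc j →
  toℕ (lookup σ a) < toℕ (lookup σ b)

Good : (n m : ℕ) → Vec (Fin (n * m)) (n * m) → Set
Good n m σ = IsPerm σ × Avoids132 σ × BlockIncreasing n m σ

module Submission where

-- The proof is an explicit enumeration.  Call σ admissible for a if it is a
-- 132-avoiding permutation whose descents σ_{j-1} > σ_j all occur at block
-- starts j = k·n with k ≤ a; for a = m and length n·m this is the property of
-- the theorem (BlockShape).  Admissible permutations obey a recursion in a and
-- the length: either σ has no descent at the block start p = (a+1)·n, and is
-- then admissible for a, or it has one, and then its minimum sits at p and
-- deleting it leaves a permutation admissible for a+1 that is one shorter
-- (minimum-at-boundary, delete-admissible); conversely inserting a new minimum
-- at p preserves admissibility (insert-admissible).  This gives a duplicate-free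
-- list 'admissibles a L' whose length satisfies the recurrence 'count', solved
-- in closed form by Pascal's rule and the absorption identity (count-formula).

open import Defs
open import Data.Nat
  using (ℕ; zero; suc; pred; _+_; _*_; _∸_; _≤_; _<_; _≤?_; _<?_; _≟_; z≤n; s≤s; s≤s⁻¹; s<s⁻¹)
open import Data.Nat.Properties
open import Data.Nat.Combinatorics using (_C_; nCk≡nC[n∸k]; nCn≡1; nC1≡n; nCk+nC[k+1]≡[n+1]C[k+1])
open import Data.Nat.DivMod
  using (_%_; _/_; m≡m%n+[m/n]*n; m%n<n; m*n%n≡0; [m+kn]%n≡m%n; m<n⇒m%n≡m; m<n*o⇒m/o<n)
open import Data.Nat.Tactic.RingSolver using (solve-∀)
open import Data.Fin using (Fin; zero; suc; toℕ; fromℕ<; punchIn; punchOut)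
import Data.Fin.Properties as Fin
open import Data.Vec using (Vec; lookup; tabulate; insertAt; allFin)
import Data.Vec as Vec
open import Data.Vec.Properties
  using (tabulate∘lookup; tabulate-cong; insertAt-lookup; insertAt-punchIn; lookup-map; lookup∘tabulate; lookup-allFin)
open import Data.List using (List; []; _∷_; _++_; map; length)
open import Data.List.Properties using (length-++; length-map)
open import Data.List.Membership.Propositional using (_∈_)
open import Data.List.Membership.Propositional.Properties using (∈-map⁺; ∈-map⁻; ∈-++⁺ˡ; ∈-++⁺ʳ; ∈-++⁻)
open import Data.List.Relation.Unary.Any using (here)
open import Data.List.Relation.Unary.Unique.Propositional using (Unique)
open import Data.List.Relation.Unary.Unique.Propositional.Properties using (++⁺; map⁺)
open import Data.List.Relation.Unary.All using ([])
open import Data.List.Relation.Unary.AllPairs using ([]; _∷_)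
open import Data.Product using (Σ; _×_; _,_; proj₁; proj₂)
open import Data.Sum using (_⊎_; inj₁; inj₂)
open import Data.Empty using (⊥; ⊥-elim)
open import Function using (_∘_)
open import Function.Bundles using (_⇔_; mk⇔; Equivalence)
open import Function.Definitions using (Injective)
open import Relation.Nullary using (Dec; yes; no; ¬_)
open import Relation.Binary using (Tri; tri<; tri≈; tri>)
open import Relation.Binary.PropositionalEquality

C-zero : ∀ N → N C 0 ≡ 1
C-zero N = trans (nCk≡nC[n∸k] {0} {N} z≤n) (nCn≡1 N)

absorption : ∀ N k → suc k * (suc N C suc k) ≡ suc N * (N C k)
absorption zero    zero    = refl
absorption zero    (suc k) = *-zeroʳ (suc (suc k))
absorption (suc N) zero    = begin
  1 * (suc (suc N) C 1)      ≡⟨ trans (*-identityˡ _) (nC1≡n (suc (suc N))) ⟩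
  suc (suc N)                ≡⟨ sym (*-identityʳ _) ⟩
  suc (suc N) * 1            ≡⟨ cong (suc (suc N) *_) (C-zero (suc N)) ⟨
  suc (suc N) * (suc N C 0)  ∎
  where open ≡-Reasoning
absorption (suc N) (suc k) = begin
  suc (suc k) * (suc (suc N) C suc (suc k))
    ≡⟨ cong (suc (suc k) *_) (pascal (suc N) (suc k)) ⟨
  suc (suc k) * (suc N C suc k + suc N C suc (suc k))
    ≡⟨ regroup k (suc N C suc k) (suc N C suc (suc k)) ⟩
  suc (suc k) * (suc N C suc (suc k)) + suc k * (suc N C suc k) + suc N C suc k
    ≡⟨ cong₂ (λ u v → u + v + suc N C suc k) (absorption N (suc k)) (absorption N k) ⟩
  suc N * (N C suc k) + suc N * (N C k) + suc N C suc k
    ≡⟨ cong (λ t → suc N * (N C suc k) + suc N * (N C k) + t) (pascal N k) ⟨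
  suc N * (N C suc k) + suc N * (N C k) + (N C k + N C suc k)
    ≡⟨ merge (suc N) (N C suc k) (N C k) ⟩
  suc (suc N) * (N C k + N C suc k)
    ≡⟨ cong (suc (suc N) *_) (pascal N k) ⟩
  suc (suc N) * (suc N C suc k) ∎
  where
  open ≡-Reasoning
  pascal : ∀ n k → n C k + n C suc k ≡ suc n C suc k
  pascal = nCk+nC[k+1]≡[n+1]C[k+1]
  regroup : ∀ k x y → suc (suc k) * (x + y) ≡ suc (suc k) * y + suc k * x + x
  regroup = solve-∀
  merge : ∀ M y x → M * y + M * x + (x + y) ≡ suc M * (x + y)
  merge = solve-∀

vec-ext : ∀ {A : Set} {L} {xs ys : Vec A L} → (∀ i → lookup xs i ≡ lookup ys i) → xs ≡ ys
vec-ext {xs = xs} {ys} same =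
  trans (sym (tabulate∘lookup xs)) (trans (tabulate-cong same) (tabulate∘lookup ys))

toℕ-punchIn-below : ∀ {L} (p : Fin (suc L)) (y : Fin L) → toℕ y < toℕ p → toℕ (punchIn p y) ≡ toℕ y
toℕ-punchIn-below zero    y       ()
toℕ-punchIn-below (suc p) zero    _         = refl
toℕ-punchIn-below (suc p) (suc y) (s≤s y<p) = cong suc (toℕ-punchIn-below p y y<p)

toℕ-punchIn-above : ∀ {L} (p : Fin (suc L)) (y : Fin L) → toℕ p ≤ toℕ y → toℕ (punchIn p y) ≡ suc (toℕ y)
toℕ-punchIn-above zero    y       _         = refl
toℕ-punchIn-above (suc p) zero    ()
toℕ-punchIn-above (suc p) (suc y) (s≤s p≤y) = cong suc (toℕ-punchIn-above p y p≤y)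

punchIn-mono-< : ∀ {L} (p : Fin (suc L)) (x y : Fin L) → toℕ x < toℕ y → toℕ (punchIn p x) < toℕ (punchIn p y)
punchIn-mono-< p x y x<y = ≰⇒> (λ y≤x → <⇒≱ x<y (Fin.punchIn-cancel-≤ p y x y≤x))

punchIn-cancel-< : ∀ {L} (p : Fin (suc L)) (x y : Fin L) →
  toℕ (punchIn p x) < toℕ (punchIn p y) → toℕ x < toℕ y
punchIn-cancel-< p x y x<y = ≰⇒> (λ y≤x → <⇒≱ x<y (Fin.punchIn-mono-≤ p y x y≤x))

punchIn-adjacent : ∀ {L} (p : Fin (suc L)) (i′ j′ : Fin L) → toℕ j′ ≡ suc (toℕ i′) → toℕ j′ ≢ toℕ p →
  toℕ (punchIn p j′) ≡ suc (toℕ (punchIn p i′))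
punchIn-adjacent p i′ j′ adj j′≢p with <-cmp (toℕ j′) (toℕ p)
... | tri< j′<p _ _ = begin
  toℕ (punchIn p j′)         ≡⟨ toℕ-punchIn-below p j′ j′<p ⟩
  toℕ j′                     ≡⟨ adj ⟩
  suc (toℕ i′)               ≡⟨ cong suc (toℕ-punchIn-below p i′ i′<p) ⟨
  suc (toℕ (punchIn p i′))   ∎
  where
  open ≡-Reasoning
  i′<p : toℕ i′ < toℕ p
  i′<p = <-trans (subst (toℕ i′ <_) (sym adj) (n<1+n (toℕ i′))) j′<p
... | tri≈ _ j′≡p _ = ⊥-elim (j′≢p j′≡p)
... | tri> _ _ p<j′ = begin
  toℕ (punchIn p j′)         ≡⟨ toℕ-punchIn-above p j′ (<⇒≤ p<j′) ⟩
  suc (toℕ j′)               ≡⟨ cong suc adj ⟩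
  suc (suc (toℕ i′))         ≡⟨ cong suc (toℕ-punchIn-above p i′ p≤i′) ⟨
  suc (toℕ (punchIn p i′))   ∎
  where
  open ≡-Reasoning
  p≤i′ : toℕ p ≤ toℕ i′
  p≤i′ = s≤s⁻¹ (subst (toℕ p <_) adj p<j′)

punchIn-adjacent⁻¹ : ∀ {L} (p : Fin (suc L)) (i′ j′ : Fin L) →
  toℕ (punchIn p j′) ≡ suc (toℕ (punchIn p i′)) →
  toℕ j′ ≡ suc (toℕ i′) × (toℕ j′ < toℕ p ⊎ toℕ p ≤ toℕ i′)
punchIn-adjacent⁻¹ p i′ j′ adj with toℕ i′ <? toℕ p | toℕ j′ <? toℕ p
... | yes i′<p | yes j′<p =
  trans (sym (toℕ-punchIn-below p j′ j′<p)) (trans adj (cong suc (toℕ-punchIn-below p i′ i′<p))) , inj₁ j′<p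
... | yes i′<p | no  j′≮p = ⊥-elim (<-irrefl j′≡i′ (<-≤-trans i′<p (≮⇒≥ j′≮p)))
  where
  j′≡i′ : toℕ i′ ≡ toℕ j′
  j′≡i′ = suc-injective (trans (cong suc (sym (toℕ-punchIn-below p i′ i′<p)))
                               (trans (sym adj) (toℕ-punchIn-above p j′ (≮⇒≥ j′≮p))))
... | no  i′≮p | yes j′<p = ⊥-elim (<-asym j′<p (≤-<-trans (≮⇒≥ i′≮p) i′<j′))
  where
  i′<j′ : toℕ i′ < toℕ j′
  i′<j′ = subst (toℕ i′ <_) (trans (cong suc (sym (toℕ-punchIn-above p i′ (≮⇒≥ i′≮p))))
                                   (trans (sym adj) (toℕ-punchIn-below p j′ j′<p)))
                (<-trans (n<1+n _) (n<1+n _))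
... | no  i′≮p | no  j′≮p =
  suc-injective (trans (sym (toℕ-punchIn-above p j′ (≮⇒≥ j′≮p)))
                       (trans adj (cong suc (toℕ-punchIn-above p i′ (≮⇒≥ i′≮p))))) , inj₂ (≮⇒≥ i′≮p)

data PunchView {L} (p : Fin (suc L)) : Fin (suc L) → Set where
  pivot : PunchView p p
  moved : (y : Fin L) → PunchView p (punchIn p y)

punchView : ∀ {L} (p x : Fin (suc L)) → PunchView p x
punchView p x with p Fin.≟ x
... | yes refl = pivot
... | no  p≢x  = subst (PunchView p) (Fin.punchIn-punchOut p≢x) (moved (punchOut p≢x))

injective⇒surjective : ∀ {L} (f : Fin L → Fin L) → Injective _≡_ _≡_ f → ∀ v → Σ (Fin L) (λ w → f w ≡ v)
injective⇒surjective {L} f inj v with Fin.any? (λ w → f w Fin.≟ v)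
... | yes hit = hit
injective⇒surjective {suc L} f inj v | no miss =
  ⊥-elim (Fin.<-irrefl (inj (Fin.punchOut-injective (avoids i) (avoids j) same)) i<j)
  where
  avoids : ∀ w → v ≢ f w
  avoids w v≡fw = miss (w , sym v≡fw)
  collision : Σ (Fin (suc L)) (λ i → Σ (Fin (suc L)) (λ j →
                toℕ i < toℕ j × punchOut (avoids i) ≡ punchOut (avoids j)))
  collision = Fin.pigeonhole (n<1+n L) (λ w → punchOut (avoids w))
  i j : Fin (suc L)
  i = proj₁ collision
  j = proj₁ (proj₂ collision)
  i<j : toℕ i < toℕ j
  i<j = proj₁ (proj₂ (proj₂ collision))
  same : punchOut (avoids i) ≡ punchOut (avoids j)
  same = proj₂ (proj₂ (proj₂ collision))

ascending-from : ∀ {L} (f : Fin L → ℕ) (u : ℕ) →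
  (∀ i j → toℕ j ≡ suc (toℕ i) → u ≤ toℕ i → f i < f j) →
  ∀ x y → u ≤ toℕ x → toℕ x < toℕ y → f x < f y
ascending-from {L} f u step x y u≤x x<y = climb (toℕ y ∸ suc (toℕ x)) y (m∸n+n≡m x<y)
  where
  climb : ∀ d y → d + suc (toℕ x) ≡ toℕ y → f x < f y
  climb zero    y reach = step x y (sym reach) u≤x
  climb (suc d) y reach =
    <-trans (climb d z (sym z≡)) (step z y (trans (sym reach) (cong suc (sym z≡))) (≤-trans u≤x x≤z))
    where
    bound : d + suc (toℕ x) < L
    bound = <⇒≤ (subst (_< L) (sym reach) (Fin.toℕ<n y))
    z : Fin L
    z = fromℕ< bound
    z≡ : toℕ z ≡ d + suc (toℕ x)
    z≡ = Fin.toℕ-fromℕ< bound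
    x≤z : toℕ x ≤ toℕ z
    x≤z = ≤-trans (≤-trans (n≤1+n (toℕ x)) (m≤n+m (suc (toℕ x)) d)) (≤-reflexive (sym z≡))

StrictlyIncreasing : ∀ {L} → (Fin L → Fin L) → Set
StrictlyIncreasing f = ∀ x y → toℕ x < toℕ y → toℕ (f x) < toℕ (f y)

increasing-lower : ∀ {L} (f : Fin L → Fin L) → StrictlyIncreasing f → ∀ x → toℕ x ≤ toℕ (f x)
increasing-lower {L} f incr x = below (toℕ x) x refl
  where
  below : ∀ k x → toℕ x ≡ k → k ≤ toℕ (f x)
  below zero    x _   = z≤n
  below (suc k) x x≡k = <-≤-trans (s≤s (below k y y≡k)) (incr y x y<x)
    where
    k<L : k < L
    k<L = <-trans (n<1+n k) (subst (_< L) x≡k (Fin.toℕ<n x))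
    y : Fin L
    y = fromℕ< k<L
    y≡k : toℕ y ≡ k
    y≡k = Fin.toℕ-fromℕ< k<L
    y<x : toℕ y < toℕ x
    y<x = subst₂ _<_ (sym y≡k) (sym x≡k) (n<1+n k)

-- A strictly increasing permutation of Fin L is the identity: its inverse is
-- again strictly increasing, so neither f nor its inverse moves a position down.
increasing-identity : ∀ {L} (f : Fin L → Fin L) → Injective _≡_ _≡_ f → StrictlyIncreasing f →
  ∀ x → f x ≡ x
increasing-identity f inj incr x =
  Fin.toℕ-injective (≤-antisym (subst (λ t → toℕ (f x) ≤ toℕ t) (g∘f x) (increasing-lower g g-incr (f x)))
                               (increasing-lower f incr x))
  where
  g : Fin _ → Fin _
  g v = proj₁ (injective⇒surjective f inj v)
  f∘g : ∀ v → f (g v) ≡ v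
  f∘g v = proj₂ (injective⇒surjective f inj v)
  g∘f : ∀ x → g (f x) ≡ x
  g∘f x = inj (f∘g (f x))
  g-incr : StrictlyIncreasing g
  g-incr u v u<v = ≰⇒> λ gv≤gu → <⇒≱ u<v (subst₂ (λ a b → toℕ a ≤ toℕ b) (f∘g v) (f∘g u) (mono gv≤gu))
    where
    mono : ∀ {a b} → toℕ a ≤ toℕ b → toℕ (f a) ≤ toℕ (f b)
    mono {a} {b} a≤b with m≤n⇒m<n∨m≡n a≤b
    ... | inj₁ a<b = <⇒≤ (incr a b a<b)
    ... | inj₂ a≡b = ≤-reflexive (cong (toℕ ∘ f) (Fin.toℕ-injective a≡b))

val : ∀ {L} → Vec (Fin L) L → Fin L → ℕ
val σ i = toℕ (lookup σ i)

record MinInserted {L} (p : Fin (suc L)) (σ : Vec (Fin (suc L)) (suc L)) (τ : Vec (Fin L) L) : Set where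
  field
    at-pivot  : lookup σ p ≡ zero
    elsewhere : ∀ j → lookup σ (punchIn p j) ≡ suc (lookup τ j)

  val-pivot : val σ p ≡ 0
  val-pivot = cong toℕ at-pivot

  val-elsewhere : ∀ j → val σ (punchIn p j) ≡ suc (val τ j)
  val-elsewhere j = cong toℕ (elsewhere j)

  compare-moved : ∀ x y → val σ (punchIn p x) < val σ (punchIn p y) → val τ x < val τ y
  compare-moved x y lt = s<s⁻¹ (subst₂ _<_ (val-elsewhere x) (val-elsewhere y) lt)

  compare-moved⁻¹ : ∀ x y → val τ x < val τ y → val σ (punchIn p x) < val σ (punchIn p y)
  compare-moved⁻¹ x y lt = subst₂ _<_ (sym (val-elsewhere x)) (sym (val-elsewhere y)) (s≤s lt)

open MinInserted public

insertMin : ∀ {L} → Fin (suc L) → Vec (Fin L) L → Vec (Fin (suc L)) (suc L)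
insertMin p τ = insertAt (Vec.map suc τ) p zero

insertMin-spec : ∀ {L} (p : Fin (suc L)) (τ : Vec (Fin L) L) → MinInserted p (insertMin p τ) τ
insertMin-spec p τ = record
  { at-pivot  = insertAt-lookup (Vec.map suc τ) p zero
  ; elsewhere = λ j → trans (insertAt-punchIn (Vec.map suc τ) p zero j) (lookup-map j suc τ)
  }

MinInserted-unique : ∀ {L} {p : Fin (suc L)} {σ σ′ τ} → MinInserted p σ τ → MinInserted p σ′ τ → σ ≡ σ′
MinInserted-unique {p = p} {σ} {σ′} ins ins′ = vec-ext (λ x → agree (punchView p x))
  where
  agree : ∀ {x} → PunchView p x → lookup σ x ≡ lookup σ′ x
  agree pivot     = trans (at-pivot ins) (sym (at-pivot ins′))
  agree (moved y) = trans (elsewhere ins y) (sym (elsewhere ins′ y))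

MinInserted-unique⁻¹ : ∀ {L} {p : Fin (suc L)} {σ τ τ′} → MinInserted p σ τ → MinInserted p σ τ′ → τ ≡ τ′
MinInserted-unique⁻¹ ins ins′ =
  vec-ext (λ j → Fin.suc-injective (trans (sym (elsewhere ins j)) (elsewhere ins′ j)))

insertMin-injective : ∀ {L} (p : Fin (suc L)) {τ τ′ : Vec (Fin L) L} → insertMin p τ ≡ insertMin p τ′ → τ ≡ τ′
insertMin-injective p {τ} {τ′} same =
  MinInserted-unique⁻¹ (insertMin-spec p τ)
                       (subst (λ σ → MinInserted p σ τ′) (sym same) (insertMin-spec p τ′))

deleteMin : ∀ {L} {p : Fin (suc L)} {σ : Vec (Fin (suc L)) (suc L)} → IsPerm σ → lookup σ p ≡ zero →
  Σ (Vec (Fin L) L) (MinInserted p σ)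
deleteMin {L} {p} {σ} perm σp≡0 = tabulate lower , record { at-pivot = σp≡0 ; elsewhere = restore }
  where
  nonzero : ∀ j → zero ≢ lookup σ (punchIn p j)
  nonzero j 0≡ = Fin.punchInᵢ≢i p j (perm (trans (sym 0≡) (sym σp≡0)))
  lower : Fin L → Fin L
  lower j = punchOut (nonzero j)
  restore : ∀ j → lookup σ (punchIn p j) ≡ suc (lookup (tabulate lower) j)
  restore j = trans (sym (Fin.punchIn-punchOut (nonzero j))) (cong suc (sym (lookup∘tabulate lower j)))

insert-perm : ∀ {L} {p : Fin (suc L)} {σ τ} → MinInserted p σ τ → IsPerm τ → IsPerm σ
insert-perm {p = p} {σ} ins perm {x} {y} = same (punchView p x) (punchView p y)
  where
  same : ∀ {x y} → PunchView p x → PunchView p y → lookup σ x ≡ lookup σ y → x ≡ y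
  same pivot     pivot     _  = refl
  same pivot     (moved y) eq = ⊥-elim (Fin.0≢1+n (trans (sym (at-pivot ins)) (trans eq (elsewhere ins y))))
  same (moved x) pivot     eq =
    ⊥-elim (Fin.0≢1+n (trans (sym (at-pivot ins)) (trans (sym eq) (elsewhere ins x))))
  same (moved x) (moved y) eq =
    cong (punchIn p) (perm (Fin.suc-injective (trans (sym (elsewhere ins x)) (trans eq (elsewhere ins y)))))

delete-perm : ∀ {L} {p : Fin (suc L)} {σ τ} → MinInserted p σ τ → IsPerm σ → IsPerm τ
delete-perm {p = p} ins perm eq =
  Fin.punchIn-injective p _ _ (perm (trans (elsewhere ins _) (trans (cong suc eq) (sym (elsewhere ins _)))))

delete-avoids : ∀ {L} {p : Fin (suc L)} {σ τ} → MinInserted p σ τ → Avoids132 σ → Avoids132 τ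
delete-avoids {p = p} ins avoids x y z x<y y<z (xz , zy) =
  avoids (punchIn p x) (punchIn p y) (punchIn p z) (punchIn-mono-< p x y x<y) (punchIn-mono-< p y z y<z)
    (compare-moved⁻¹ ins x z xz , compare-moved⁻¹ ins z y zy)

module Blocks (n′ : ℕ) where

  n : ℕ
  n = suc n′

  -- The recurrence satisfied by the number of admissible permutations
  -- (length-admissibles): for a+1 blocks and length L+1, the block start
  -- (a+1)·n either does not fit (only stage a contributes) or does (a new
  -- minimum may be inserted there into a shorter permutation).
  count : ℕ → ℕ → ℕ
  count zero    L       = 1
  count (suc a) zero    = count a zero
  count (suc a) (suc L) with suc a * n ≤? L
  ... | yes _ = count a (suc L) + count (suc a) L
  ... | no  _ = count a (suc L)

  count-open : ∀ a L → suc a * n ≤ L → count (suc a) (suc L) ≡ count a (suc L) + count (suc a) L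
  count-open a L room with suc a * n ≤? L
  ... | yes _    = refl
  ... | no  full = ⊥-elim (full room)

  count-full : ∀ a L → ¬ (suc a * n ≤ L) → count (suc a) (suc L) ≡ count a (suc L)
  count-full a L full with suc a * n ≤? L
  ... | yes room = ⊥-elim (full room)
  ... | no  _    = refl

  -- Closed form at a new block start L = (a+1)·n, from the one for a blocks.
  boundary-step : ∀ a g → suc (suc a * n) * g ≡ suc n * ((suc a * n + a) C a) →
    suc (suc a * n) * g ≡ (suc a * n + suc a) C suc a
  boundary-step a g hyp = *-cancelˡ-≡ _ _ (suc a) (begin
      suc a * (suc M * g)                ≡⟨ cong (suc a *_) hyp ⟩
      suc a * (suc n * ((M + a) C a))    ≡⟨ reassoc a n ((M + a) C a) ⟩
      suc (M + a) * ((M + a) C a)        ≡⟨ absorption (M + a) a ⟨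
      suc a * (suc (M + a) C suc a)      ≡⟨ cong (λ t → suc a * (t C suc a)) (+-suc M a) ⟨
      suc a * ((M + suc a) C suc a)      ∎)
    where
    open ≡-Reasoning
    M : ℕ
    M = suc a * n
    reassoc : ∀ a n x → suc a * (suc n * x) ≡ suc (suc a * n + a) * x
    reassoc = solve-∀

  -- Closed form at L + 1 = (a+1)·n + (s+1), from the two terms of the recurrence.
  interior-step : ∀ a s g₁ g₂ →
    suc (suc (suc a * n + s)) * g₁ ≡ suc (n + suc s) * ((suc (suc a * n + s) + a) C a) →
    suc (suc a * n + s) * g₂ ≡ suc s * ((suc a * n + s + suc a) C suc a) →
    suc (suc (suc a * n + s)) * (g₁ + g₂) ≡ suc (suc s) * (suc (suc a * n + s + suc a) C suc a)
  interior-step a s g₁ g₂ hyp₁ hyp₂ = *-cancelˡ-≡ _ _ (suc S) (begin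
      suc S * (suc (suc S) * (g₁ + g₂))
        ≡⟨ spread S g₁ g₂ ⟩
      suc S * (suc (suc S) * g₁) + suc (suc S) * (suc S * g₂)
        ≡⟨ cong₂ (λ u v → suc S * u + suc (suc S) * v) hyp₁′ hyp₂ ⟩
      suc S * (suc (n + suc s) * X) + suc (suc S) * (suc s * Y)
        ≡⟨ regroup S n s X Y ⟩
      suc (suc s) * (suc S * X) + n * (suc S * X) + suc (suc S) * (suc s * Y)
        ≡⟨ cong (λ t → suc (suc s) * (suc S * X) + n * t + suc (suc S) * (suc s * Y)) ratio ⟩
      suc (suc s) * (suc S * X) + n * (suc a * Y) + suc (suc S) * (suc s * Y)
        ≡⟨ collect a n s X Y ⟩
      suc S * (suc (suc s) * (X + Y))
        ≡⟨ cong (λ t → suc S * (suc (suc s) * t)) (nCk+nC[k+1]≡[n+1]C[k+1] K a) ⟩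
      suc S * (suc (suc s) * (suc K C suc a)) ∎)
    where
    open ≡-Reasoning
    S K X Y : ℕ
    S = suc a * n + s
    K = S + suc a
    X = K C a
    Y = K C suc a
    hyp₁′ : suc (suc S) * g₁ ≡ suc (n + suc s) * X
    hyp₁′ = trans hyp₁ (cong (λ t → suc (n + suc s) * (t C a)) (sym (+-suc S a)))
    ratio : suc S * X ≡ suc a * Y
    ratio = +-cancelʳ-≡ (suc a * X) _ _ (begin
      suc S * X + suc a * X                ≡⟨ *-distribʳ-+ X (suc S) (suc a) ⟨
      suc K * X                            ≡⟨ absorption K a ⟨
      suc a * (suc K C suc a)              ≡⟨ cong (suc a *_) (nCk+nC[k+1]≡[n+1]C[k+1] K a) ⟨
      suc a * (X + Y)       ≡⟨ trans (*-distribˡ-+ (suc a) X Y) (+-comm (suc a * X) (suc a * Y)) ⟩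
      suc a * Y + suc a * X                ∎)
    spread : ∀ S g₁ g₂ → suc S * (suc (suc S) * (g₁ + g₂))
                         ≡ suc S * (suc (suc S) * g₁) + suc (suc S) * (suc S * g₂)
    spread = solve-∀
    regroup : ∀ S n s X Y → suc S * (suc (n + suc s) * X) + suc (suc S) * (suc s * Y)
              ≡ suc (suc s) * (suc S * X) + n * (suc S * X) + suc (suc S) * (suc s * Y)
    regroup = solve-∀
    collect : ∀ a n s X Y →
      suc (suc s) * (suc (suc a * n + s) * X) + n * (suc a * Y) + suc (suc (suc a * n + s)) * (suc s * Y)
      ≡ suc (suc a * n + s) * (suc (suc s) * (X + Y))
    collect = solve-∀

  count-formula : ∀ a s {L} → a * n + s ≡ L → suc L * count a L ≡ suc s * ((L + a) C a)
  count-formula zero    s       refl = cong (suc s *_) (sym (C-zero (s + 0)))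
  count-formula (suc a) zero    refl = begin
    suc (M + 0) * count (suc a) (M + 0)  ≡⟨ cong (λ t → suc t * count (suc a) t) (+-identityʳ M) ⟩
    suc M * count (suc a) M              ≡⟨ cong (suc M *_) (count-full a (n′ + a * n) (<-irrefl refl)) ⟩
    suc M * count a M
      ≡⟨ boundary-step a (count a M) (count-formula a n {M} (+-comm (a * n) n)) ⟩
    (M + suc a) C suc a                  ≡⟨ cong (λ t → (t + suc a) C suc a) (+-identityʳ M) ⟨
    (M + 0 + suc a) C suc a              ≡⟨ *-identityˡ ((M + 0 + suc a) C suc a) ⟨
    1 * ((M + 0 + suc a) C suc a)        ∎
    where
    open ≡-Reasoning
    M : ℕ
    M = suc a * n
  count-formula (suc a) (suc s) refl = begin
    suc (M + suc s) * count (suc a) (M + suc s)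
      ≡⟨ cong (suc (M + suc s) *_) (count-open a (n′ + a * n + suc s) room) ⟩
    suc (M + suc s) * (count a (M + suc s) + count (suc a) (n′ + a * n + suc s))
      ≡⟨ cong (λ t → suc t * (count a t + count (suc a) (pred t))) (+-suc M s) ⟩
    suc (suc (M + s)) * (count a (suc (M + s)) + count (suc a) (M + s))
      ≡⟨ interior-step a s (count a (suc (M + s))) (count (suc a) (M + s))
           (count-formula a (n + suc s) {suc (M + s)} shifted) (count-formula (suc a) s refl) ⟩
    suc (suc s) * (suc (M + s + suc a) C suc a)
      ≡⟨ cong (λ t → suc (suc s) * ((t + suc a) C suc a)) (+-suc M s) ⟨
    suc (suc s) * ((M + suc s + suc a) C suc a) ∎
    where
    open ≡-Reasoning
    M : ℕ
    M = suc a * n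
    room : M ≤ n′ + a * n + suc s
    room = ≤-trans (s≤s (m≤m+n (n′ + a * n) s)) (≤-reflexive (sym (+-suc (n′ + a * n) s)))
    shifted : a * n + (n + suc s) ≡ suc (M + s)
    shifted = trans (sym (+-assoc (a * n) n (suc s)))
                    (trans (cong (_+ suc s) (+-comm (a * n) n)) (+-suc M s))

  BoundaryDescents : ∀ {L} → ℕ → Vec (Fin L) L → Set
  BoundaryDescents {L} a σ = (i j : Fin L) → toℕ j ≡ suc (toℕ i) → val σ j < val σ i →
    Σ ℕ (λ k → k ≤ a × toℕ j ≡ k * n)

  record Admissible {L} (a : ℕ) (σ : Vec (Fin L) L) : Set where
    field
      perm     : IsPerm σ
      avoids   : Avoids132 σ
      descents : BoundaryDescents a σ

  open Admissible public

  block-start-≤ : ∀ {k c j} → k ≤ c → j ≡ k * n → j ≤ c * n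
  block-start-≤ k≤c refl = *-monoˡ-≤ n k≤c

  ascent : ∀ {L} (σ : Vec (Fin L) L) → IsPerm σ → ∀ i j → toℕ j ≡ suc (toℕ i) →
    ¬ (val σ j < val σ i) → val σ i < val σ j
  ascent σ σ-perm i j adj no-descent = ≤∧≢⇒< (≮⇒≥ no-descent)
    (λ same → <-irrefl (trans (cong toℕ (σ-perm (Fin.toℕ-injective same))) adj) (n<1+n (toℕ i)))

  increasing-beyond : ∀ {L} (σ : Vec (Fin L) L) c → IsPerm σ → BoundaryDescents c σ →
    ∀ x y → c * n ≤ toℕ x → toℕ x < toℕ y → val σ x < val σ y
  increasing-beyond σ c σ-perm desc = ascending-from (val σ) (c * n) local
    where
    local : ∀ i j → toℕ j ≡ suc (toℕ i) → c * n ≤ toℕ i → val σ i < val σ j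
    local i j adj cn≤i = ascent σ σ-perm i j adj λ descent →
      let (k , k≤c , j≡kn) = desc i j adj descent in
      <⇒≱ (subst (c * n <_) (sym adj) (s≤s cn≤i)) (block-start-≤ k≤c j≡kn)

  admissible-weaken : ∀ {L a} {σ : Vec (Fin L) L} → Admissible a σ → Admissible (suc a) σ
  admissible-weaken adm = record
    { perm = perm adm ; avoids = avoids adm
    ; descents = λ i j adj d → let (k , k≤a , j≡kn) = descents adm i j adj d in k , m≤n⇒m≤1+n k≤a , j≡kn }

  admissible-restrict : ∀ {L a} {σ : Vec (Fin L) L} → Admissible (suc a) σ →
    (∀ i j → toℕ j ≡ suc (toℕ i) → toℕ j ≡ suc a * n → ¬ (val σ j < val σ i)) → Admissible a σ
  admissible-restrict {a = a} {σ} adm no-descent = record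
    { perm = perm adm ; avoids = avoids adm ; descents = desc }
    where
    desc : BoundaryDescents a σ
    desc i j adj d with descents adm i j adj d
    ... | k , k≤1+a , j≡kn with m≤n⇒m<n∨m≡n k≤1+a
    ...   | inj₁ k<1+a = k , s≤s⁻¹ k<1+a , j≡kn
    ...   | inj₂ refl  = ⊥-elim (no-descent i j adj j≡kn d)

  identity-admissible : ∀ L → Admissible 0 (allFin L)
  identity-admissible L = record
    { perm     = λ {x} {y} eq → trans (sym (lookup-allFin x)) (trans eq (lookup-allFin y))
    ; avoids   = λ a b c _ b<c (_ , cb) → <-asym b<c (subst₂ _<_ (id-val c) (id-val b) cb)
    ; descents = λ i j adj d →
        ⊥-elim (<-asym (subst (toℕ i <_) (sym adj) (n<1+n _)) (subst₂ _<_ (id-val j) (id-val i) d))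
    }
    where
    id-val : ∀ i → val (allFin L) i ≡ toℕ i
    id-val i = cong toℕ (lookup-allFin i)

  admissible-zero⇒identity : ∀ {L} {σ : Vec (Fin L) L} → Admissible 0 σ → σ ≡ allFin L
  admissible-zero⇒identity {σ = σ} adm = vec-ext (λ i →
    trans (increasing-identity (lookup σ) (perm adm) increasing i) (sym (lookup-allFin i)))
    where
    increasing : StrictlyIncreasing (lookup σ)
    increasing x y = increasing-beyond σ 0 (perm adm) (descents adm) x y z≤n

  insert-admissible : ∀ {L a} {p : Fin (suc L)} {σ τ} → toℕ p ≡ suc a * n → MinInserted p σ τ →
    Admissible (suc a) τ → Admissible (suc a) σ
  insert-admissible {a = a} {p} {σ} p≡ ins adm =
    record { perm = σ-perm ; avoids = σ-avoids ; descents = σ-descents }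
    where
    σ-perm : IsPerm σ
    σ-perm = insert-perm ins (perm adm)

    -- A descent of σ ends at p, or comes from a descent of τ below p; it cannot
    -- start at p (σ_p = 0), and τ has no descents beyond p.
    descent-at : ∀ {i j} → PunchView p i → PunchView p j → toℕ j ≡ suc (toℕ i) → val σ j < val σ i →
      Σ ℕ (λ k → k ≤ suc a × toℕ j ≡ k * n)
    descent-at _          pivot      _   _ = suc a , ≤-refl , p≡
    descent-at pivot      (moved j′) _   d = ⊥-elim (n≮0 (subst (val σ (punchIn p j′) <_) (val-pivot ins) d))
    descent-at (moved i′) (moved j′) adj d with punchIn-adjacent⁻¹ p i′ j′ adj
    ... | adj′ , side with descents adm i′ j′ adj′ (compare-moved ins j′ i′ d)
    ...   | k , k≤ , j′≡ with side
    ...     | inj₁ j′<p = k , k≤ , trans (toℕ-punchIn-below p j′ j′<p) j′≡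
    ...     | inj₂ p≤i′ = ⊥-elim (<⇒≱ (subst (toℕ i′ <_) (sym adj′) (n<1+n (toℕ i′)))
                                        (≤-trans (block-start-≤ k≤ j′≡) (subst (_≤ toℕ i′) p≡ p≤i′)))

    σ-descents : BoundaryDescents (suc a) σ
    σ-descents i j = descent-at (punchView p i) (punchView p j)

    -- A 132 pattern cannot use the entry 0 as its middle or last entry, nor as
    -- its first one (the entries after p increase); otherwise it lies in τ.
    pattern132 : ∀ {x y z} → PunchView p x → PunchView p y → PunchView p z → toℕ x < toℕ y → toℕ y < toℕ z →
      val σ x < val σ z → val σ z < val σ y → ⊥
    pattern132 {x} _ _ pivot _ _ xz _ = n≮0 (subst (val σ x <_) (val-pivot ins) xz)
    pattern132 {z = z} _ pivot _ _ _ _ zy = n≮0 (subst (val σ z <_) (val-pivot ins) zy)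
    pattern132 {y = y} {z} pivot _ _ x<y y<z _ zy =
      <-asym zy (increasing-beyond σ (suc a) σ-perm σ-descents y z (subst (_≤ toℕ y) p≡ (<⇒≤ x<y)) y<z)
    pattern132 (moved x) (moved y) (moved z) x<y y<z xz zy =
      avoids adm x y z (punchIn-cancel-< p x y x<y) (punchIn-cancel-< p y z y<z)
        (compare-moved ins x z xz , compare-moved ins z y zy)

    σ-avoids : Avoids132 σ
    σ-avoids x y z x<y y<z (xz , zy) =
      pattern132 (punchView p x) (punchView p y) (punchView p z) x<y y<z xz zy

  -- If σ is admissible for a+1 and descends into the block start p = (a+1)·n,
  -- then σ_p = 0: a smaller entry after p would break the final increasing run,
  -- and one before the predecessor p⁻ of p would start a 132 pattern.
  minimum-at-boundary : ∀ {L a} {σ : Vec (Fin (suc L)) (suc L)} (p p⁻ : Fin (suc L)) →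
    toℕ p ≡ suc a * n → toℕ p ≡ suc (toℕ p⁻) → Admissible (suc a) σ → val σ p < val σ p⁻ →
    lookup σ p ≡ zero
  minimum-at-boundary {a = a} {σ} p p⁻ p≡ p-adj adm descent = by-position (<-cmp (toℕ w) (toℕ p))
    where
    preimage : Σ (Fin _) (λ w → lookup σ w ≡ zero)
    preimage = injective⇒surjective (lookup σ) (perm adm) zero
    w : Fin _
    w = proj₁ preimage
    w-val : val σ w ≡ 0
    w-val = cong toℕ (proj₂ preimage)
    by-position : Tri (toℕ w < toℕ p) (toℕ w ≡ toℕ p) (toℕ p < toℕ w) → lookup σ p ≡ zero
    by-position (tri≈ _ w≡p _) = subst (λ v → lookup σ v ≡ zero) (Fin.toℕ-injective w≡p) (proj₂ preimage)
    by-position (tri> _ _ p<w) = ⊥-elim (n≮0 (subst (val σ p <_) w-val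
      (increasing-beyond σ (suc a) (perm adm) (descents adm) p w (≤-reflexive (sym p≡)) p<w)))
    by-position (tri< w<p _ _) with toℕ w ≟ toℕ p⁻
    ... | yes w≡p⁻ = ⊥-elim (n≮0 (subst (val σ p <_) w⁻-val descent))
      where
      w⁻-val : val σ p⁻ ≡ 0
      w⁻-val = trans (cong (val σ) (Fin.toℕ-injective (sym w≡p⁻))) w-val
    ... | no  w≢p⁻ = ⊥-elim (avoids adm w p⁻ p w<p⁻ p⁻<p (subst (_< val σ p) (sym w-val) σp>0 , descent))
      where
      w<p⁻ : toℕ w < toℕ p⁻
      w<p⁻ = ≤∧≢⇒< (s≤s⁻¹ (subst (toℕ w <_) p-adj w<p)) w≢p⁻
      p⁻<p : toℕ p⁻ < toℕ p
      p⁻<p = subst (toℕ p⁻ <_) (sym p-adj) (n<1+n (toℕ p⁻))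
      σp>0 : 0 < val σ p
      σp>0 = n≢0⇒n>0 (λ σp≡0 →
        <-irrefl (cong toℕ (perm adm (Fin.toℕ-injective (trans w-val (sym σp≡0))))) w<p)

  delete-admissible : ∀ {L a} {p : Fin (suc L)} {σ τ} → toℕ p ≡ suc a * n → MinInserted p σ τ →
    Admissible (suc a) σ → Admissible (suc a) τ
  delete-admissible {a = a} {p} {τ = τ} p≡ ins adm = record
    { perm = delete-perm ins (perm adm) ; avoids = delete-avoids ins (avoids adm) ; descents = τ-descents }
    where
    τ-descents : BoundaryDescents (suc a) τ
    τ-descents i′ j′ adj d with toℕ j′ ≟ toℕ p
    ... | yes j′≡p = suc a , ≤-refl , trans j′≡p p≡
    ... | no  j′≢p with descents adm (punchIn p i′) (punchIn p j′) (punchIn-adjacent p i′ j′ adj j′≢p)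
                                     (compare-moved⁻¹ ins j′ i′ d)
    ...   | k , k≤ , pj′≡ with toℕ j′ <? toℕ p
    ...     | yes j′<p = k , k≤ , trans (sym (toℕ-punchIn-below p j′ j′<p)) pj′≡
    ...     | no  j′≮p = ⊥-elim (<⇒≱ p<pj′ (≤-trans (block-start-≤ k≤ pj′≡) (≤-reflexive (sym p≡))))
      where
      p<pj′ : toℕ p < toℕ (punchIn p j′)
      p<pj′ = subst (toℕ p <_) (sym (toℕ-punchIn-above p j′ (≮⇒≥ j′≮p))) (s≤s (≮⇒≥ j′≮p))

  minimum-at-boundary⇒¬admissible : ∀ {L a} {σ : Vec (Fin (suc L)) (suc L)} (p p⁻ : Fin (suc L)) →
    toℕ p ≡ suc a * n → toℕ p ≡ suc (toℕ p⁻) → lookup σ p ≡ zero → ¬ Admissible a σ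
  minimum-at-boundary⇒¬admissible {a = a} {σ} p p⁻ p≡ p-adj σp≡0 adm =
    let (k , k≤a , p≡kn) = descents adm p⁻ p p-adj descent in
    <⇒≱ (m<n+m (a * n) (s≤s z≤n)) (subst (_≤ a * n) p≡ (block-start-≤ k≤a p≡kn))
    where
    σp-val : val σ p ≡ 0
    σp-val = cong toℕ σp≡0
    p⁻≢p : p⁻ ≢ p
    p⁻≢p p⁻≡p = <-irrefl (cong toℕ p⁻≡p) (subst (toℕ p⁻ <_) (sym p-adj) (n<1+n (toℕ p⁻)))
    descent : val σ p < val σ p⁻
    descent = subst (_< val σ p⁻) (sym σp-val)
      (n≢0⇒n>0 (λ σp⁻≡0 → p⁻≢p (perm adm (Fin.toℕ-injective (trans σp⁻≡0 (sym σp-val))))))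

  module Boundary (a L : ℕ) (room : suc a * n ≤ L) where
    p : Fin (suc L)
    p = fromℕ< (s≤s room)

    p≡ : toℕ p ≡ suc a * n
    p≡ = Fin.toℕ-fromℕ< (s≤s room)

    p⁻ : Fin (suc L)
    p⁻ = fromℕ< (m<n⇒m<1+n room)

    p-adj : toℕ p ≡ suc (toℕ p⁻)
    p-adj = trans p≡ (cong suc (sym (Fin.toℕ-fromℕ< (m<n⇒m<1+n room))))

  admissibles : ℕ → (L : ℕ) → List (Vec (Fin L) L)
  admissibles zero    L       = allFin L ∷ []
  admissibles (suc a) zero    = admissibles a zero
  admissibles (suc a) (suc L) with suc a * n ≤? L
  ... | yes room = admissibles a (suc L) ++ map (insertMin (Boundary.p a L room)) (admissibles (suc a) L)
  ... | no  _    = admissibles a (suc L)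

  admissibles-sound : ∀ a L σ → σ ∈ admissibles a L → Admissible a σ
  admissibles-sound zero    L       σ (here refl) = identity-admissible L
  admissibles-sound (suc a) zero    σ σ∈ = admissible-weaken (admissibles-sound a zero σ σ∈)
  admissibles-sound (suc a) (suc L) σ σ∈ with suc a * n ≤? L
  ... | no  _    = admissible-weaken (admissibles-sound a (suc L) σ σ∈)
  ... | yes room = from-parts (∈-++⁻ (admissibles a (suc L)) σ∈)
    where
    open Boundary a L room
    from-parts : σ ∈ admissibles a (suc L) ⊎ σ ∈ map (insertMin p) (admissibles (suc a) L) →
      Admissible (suc a) σ
    from-parts (inj₁ σ∈old) = admissible-weaken (admissibles-sound a (suc L) σ σ∈old)
    from-parts (inj₂ σ∈new) with ∈-map⁻ (insertMin p) σ∈new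
    ... | τ , τ∈ , σ≡ = subst (Admissible (suc a)) (sym σ≡)
          (insert-admissible p≡ (insertMin-spec p τ) (admissibles-sound (suc a) L τ τ∈))

  -- ... and every admissible permutation is listed: without a descent at the
  -- block start it is admissible for a, with one it arises by inserting its
  -- minimum there into the shorter permutation obtained by deleting it.
  admissibles-complete : ∀ a L σ → Admissible a σ → σ ∈ admissibles a L
  admissibles-complete zero    L       σ adm = here (admissible-zero⇒identity adm)
  admissibles-complete (suc a) zero    σ adm =
    admissibles-complete a zero σ (admissible-restrict adm (λ ()))
  admissibles-complete (suc a) (suc L) σ adm with suc a * n ≤? L
  ... | no full = admissibles-complete a (suc L) σ (admissible-restrict adm out-of-range)
    where
    out-of-range : ∀ i j → toℕ j ≡ suc (toℕ i) → toℕ j ≡ suc a * n → ¬ (val σ j < val σ i)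
    out-of-range i j _ j≡ _ = full (s≤s⁻¹ (subst (_< suc L) j≡ (Fin.toℕ<n j)))
  ... | yes room with val σ (Boundary.p a L room) <? val σ (Boundary.p⁻ a L room)
  ...   | no no-descent = ∈-++⁺ˡ (admissibles-complete a (suc L) σ (admissible-restrict adm only-here))
    where
    open Boundary a L room
    only-here : ∀ i j → toℕ j ≡ suc (toℕ i) → toℕ j ≡ suc a * n → ¬ (val σ j < val σ i)
    only-here i j adj j≡ = subst₂ (λ u v → ¬ (val σ u < val σ v)) (sym j≡p) (sym i≡p⁻) no-descent
      where
      j≡p : j ≡ p
      j≡p = Fin.toℕ-injective (trans j≡ (sym p≡))
      i≡p⁻ : i ≡ p⁻
      i≡p⁻ = Fin.toℕ-injective (suc-injective (trans (sym adj) (trans j≡ (trans (sym p≡) p-adj))))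
  ...   | yes descent = ∈-++⁺ʳ (admissibles a (suc L))
          (subst (_∈ map (insertMin p) (admissibles (suc a) L)) (sym σ≡)
                 (∈-map⁺ (insertMin p) (admissibles-complete (suc a) L τ (delete-admissible p≡ ins adm))))
    where
    open Boundary a L room
    deleted : Σ (Vec (Fin L) L) (MinInserted p σ)
    deleted = deleteMin (perm adm) (minimum-at-boundary p p⁻ p≡ p-adj adm descent)
    τ : Vec (Fin L) L
    τ = proj₁ deleted
    ins : MinInserted p σ τ
    ins = proj₂ deleted
    σ≡ : σ ≡ insertMin p τ
    σ≡ = MinInserted-unique ins (insertMin-spec p τ)

  -- Two permutations in the two parts of the recursion differ: the inserted ones
  -- are not admissible for a.
  admissibles-unique : ∀ a L → Unique (admissibles a L)
  admissibles-unique zero    L       = [] ∷ []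
  admissibles-unique (suc a) zero    = admissibles-unique a zero
  admissibles-unique (suc a) (suc L) with suc a * n ≤? L
  ... | no  _    = admissibles-unique a (suc L)
  ... | yes room = ++⁺ (admissibles-unique a (suc L))
                       (map⁺ (insertMin-injective p) (admissibles-unique (suc a) L)) disjoint
    where
    open Boundary a L room
    disjoint : ∀ {σ} → ¬ (σ ∈ admissibles a (suc L) × σ ∈ map (insertMin p) (admissibles (suc a) L))
    disjoint (σ∈old , σ∈new) with ∈-map⁻ (insertMin p) σ∈new
    ... | τ , _ , refl = minimum-at-boundary⇒¬admissible p p⁻ p≡ p-adj (at-pivot (insertMin-spec p τ))
                           (admissibles-sound a (suc L) _ σ∈old)

  length-admissibles : ∀ a L → length (admissibles a L) ≡ count a L
  length-admissibles zero    L       = refl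
  length-admissibles (suc a) zero    = length-admissibles a zero
  length-admissibles (suc a) (suc L) with suc a * n ≤? L
  ... | no  _    = length-admissibles a (suc L)
  ... | yes room = begin
    length (admissibles a (suc L) ++ map (insertMin p) (admissibles (suc a) L))
      ≡⟨ length-++ (admissibles a (suc L)) ⟩
    length (admissibles a (suc L)) + length (map (insertMin p) (admissibles (suc a) L))
      ≡⟨ cong (length (admissibles a (suc L)) +_) (length-map (insertMin p) (admissibles (suc a) L)) ⟩
    length (admissibles a (suc L)) + length (admissibles (suc a) L)
      ≡⟨ cong₂ _+_ (length-admissibles a (suc L)) (length-admissibles (suc a) L) ⟩
    count a (suc L) + count (suc a) L ∎
    where
    open ≡-Reasoning
    open Boundary a L room

  module BlockShape (m : ℕ) where

    inside-block : ∀ i j k → suc j < n → i * n + suc j ≢ k * n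
    inside-block i j k j<n eq = 0≢1+n (begin
      0                     ≡⟨ m*n%n≡0 k n ⟨
      (k * n) % n           ≡⟨ cong (_% n) eq ⟨
      (i * n + suc j) % n   ≡⟨ cong (_% n) (+-comm (i * n) (suc j)) ⟩
      (suc j + i * n) % n   ≡⟨ [m+kn]%n≡m%n (suc j) i n ⟩
      suc j % n             ≡⟨ m<n⇒m%n≡m j<n ⟩
      suc j                 ∎)
      where open ≡-Reasoning

    descents⇒block-increasing : ∀ σ → IsPerm σ → BoundaryDescents m σ → BlockIncreasing n m σ
    descents⇒block-increasing σ σ-perm desc x y i j _ j<n x≡ y≡ = ascent σ σ-perm x y adj λ descent →
      let (k , _ , y≡kn) = desc x y adj descent in inside-block i j k j<n (trans (sym y≡) y≡kn)
      where
      adj : toℕ y ≡ suc (toℕ x)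
      adj = trans y≡ (trans (+-suc (i * n) j) (cong suc (sym x≡)))

    block-increasing⇒descents : ∀ σ → BlockIncreasing n m σ → BoundaryDescents m σ
    block-increasing⇒descents σ incr x y adj descent = by-remainder (suc r <? n)
      where
      q r : ℕ
      q = toℕ x / n
      r = toℕ x % n
      x≡ : toℕ x ≡ r + q * n
      x≡ = m≡m%n+[m/n]*n (toℕ x) n
      -- Inside a block the step x → y would be an ascent; so x ends its block.
      by-remainder : Dec (suc r < n) → Σ ℕ (λ k → k ≤ m × toℕ y ≡ k * n)
      by-remainder (yes r+1<n) = ⊥-elim (<-asym descent (incr x y q r q<m r+1<n x≡′ y≡′))
        where
        x≡′ : toℕ x ≡ q * n + r
        x≡′ = trans x≡ (+-comm r (q * n))
        y≡′ : toℕ y ≡ q * n + suc r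
        y≡′ = trans adj (trans (cong suc x≡′) (sym (+-suc (q * n) r)))
        q<m : q < m
        q<m = m<n*o⇒m/o<n (subst (toℕ x <_) (*-comm n m) (Fin.toℕ<n x))
      by-remainder (no r+1≮n) = suc q , <⇒≤ q+1<m , y≡
        where
        y≡ : toℕ y ≡ suc q * n
        y≡ = begin
          toℕ y           ≡⟨ adj ⟩
          suc (toℕ x)     ≡⟨ cong suc x≡ ⟩
          suc r + q * n   ≡⟨ cong (_+ q * n) (≤-antisym (m%n<n (toℕ x) n) (≮⇒≥ r+1≮n)) ⟩
          n + q * n       ∎
          where open ≡-Reasoning
        q+1<m : suc q < m
        q+1<m = *-cancelʳ-< n (suc q) m (subst₂ _<_ y≡ (*-comm n m) (Fin.toℕ<n y))

    admissible⇔good : (σ : Vec (Fin (n * m)) (n * m)) → Admissible m σ ⇔ Good n m σ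
    admissible⇔good σ = mk⇔
      -- IsPerm has implicit arguments, so its proof is η-expanded to fit the product.
      (λ adm → (λ {x} {y} → perm adm {x} {y}) , avoids adm ,
               descents⇒block-increasing σ (perm adm) (descents adm))
      (λ (σ-perm , σ-avoids , σ-blocks) → record
        { perm = σ-perm ; avoids = σ-avoids ; descents = block-increasing⇒descents σ σ-blocks })

corollary7 : (n m : ℕ) → 1 ≤ n →
    Σ (List (Vec (Fin (n * m)) (n * m))) (λ L →
      Unique L × ((σ : Vec (Fin (n * m)) (n * m)) → (σ ∈ L) ⇔ Good n m σ)
      × (n * m + 1) * length L ≡ ((suc n) * m) C m)
corollary7 zero      m ()
corollary7 (suc n′) m _ =
  admissibles m N , admissibles-unique m N , membership , cardinality
  where
  open Blocks n′
  open BlockShape m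
  N : ℕ
  N = n * m
  membership : (σ : Vec (Fin N) N) → (σ ∈ admissibles m N) ⇔ Good n m σ
  membership σ = mk⇔ (Equivalence.to (admissible⇔good σ) ∘ admissibles-sound m N σ)
                     (admissibles-complete m N σ ∘ Equivalence.from (admissible⇔good σ))
  cardinality : (N + 1) * length (admissibles m N) ≡ (suc n * m) C m
  cardinality = begin
    (N + 1) * length (admissibles m N)  ≡⟨ cong₂ _*_ (+-comm N 1) (length-admissibles m N) ⟩
    suc N * count m N                   ≡⟨ count-formula m 0 (trans (+-identityʳ (m * n)) (*-comm m n)) ⟩
    1 * ((N + m) C m)                   ≡⟨ trans (*-identityˡ _) (cong (_C m) (+-comm N m)) ⟩
    (suc n * m) C m                     ∎
    where open ≡-Reasoning
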